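{- Let $\Sigma$ be a finite alphabet, $a\in\Sigma^*$ a finite string, and $\omega\in\Sigma^{\mathbb{N}}$ a periodic sequence with period $l$ (i.e. $\omega(i)=\omega(i+l)$ for all $i$). If the sequence $a\omega$ (the string $a$ followed by $\omega$) is strongly almost periodic, then $a\omega$ is periodic with period $l$.
   Context: A sequence is strongly almost periodic if for every factor (nonempty finite string occurring in it) $x$ there is $L$ such that every factor of length $L$ contains an occurrence of $x$. -}

module Defs where

open import Data.Nat using (ℕ; _+_; _∸_; _<_; _≤_; _<?_)
open import Data.Fin using (Fin; fromℕ<)
open import Data.List using (List; []; length; lookup)
open import Data.Product using (Σ; ∃; _×_)
open import Relation.Nullary using (¬_; yes; no)
open import Relation.Binary.PropositionalEquality using (_≡_)

Seq : Set → Set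
Seq A = ℕ → A

OccursAt : {A : Set} → Seq A → List A → ℕ → Set
OccursAt s x i = (j : ℕ) → (j<|x| : j < length x) → s (i + j) ≡ lookup x (fromℕ< j<|x|)

Factor : {A : Set} → Seq A → List A → Set
Factor s x = ¬ (x ≡ []) × ∃ λ i → OccursAt s x i

WindowContains : {A : Set} → Seq A → ℕ → ℕ → List A → Set
WindowContains s p L x = ∃ λ j → (j + length x ≤ L) × OccursAt s x (p + j)

-- Strongly almost periodic: for every factor x there is L such that every
-- factor of length L (i.e. the window s(p) … s(p+L-1), for every p) contains x.
StronglyAlmostPeriodic : {A : Set} → Seq A → Set
StronglyAlmostPeriodic s =
  (x : List _) → Factor s x → ∃ λ L → (p : ℕ) → WindowContains s p L x

HasPeriod : {A : Set} → Seq A → ℕ → Set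
HasPeriod s l = (i : ℕ) → s i ≡ s (i + l)

prepend : {A : Set} → List A → Seq A → Seq A
prepend a ω i with i <? length a
... | yes i<|a| = lookup a (fromℕ< i<|a|)
... | no _ = ω (i ∸ length a)

-- Take the factor x = s(i) … s(i + l) of s = a ω. Strong almost periodicity makes x occur
-- somewhere inside the ω part of s, where s has period l; comparing the first and last
-- letters of that occurrence gives s(i) = s(i + l).
module Submission where

open import Defs
open import Data.Nat using (ℕ; suc; _+_; _≤_; _<_; _<?_; s≤s; z≤n)
open import Data.Nat.Properties using (m+n∸m≡n; m+n≮m; +-assoc; +-identityʳ; ≤-refl)
open import Data.Fin using (Fin; fromℕ<)
open import Data.Fin.Properties using (toℕ-fromℕ<)
open import Data.List using (List; length; lookup; applyUpTo)
open import Data.List.Properties using (length-applyUpTo; lookup-applyUpTo)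
open import Data.Product using (∃; _,_)
open import Data.Empty using (⊥-elim)
open import Relation.Nullary using (yes; no)
open import Relation.Binary.PropositionalEquality using (_≡_; refl; sym; trans; cong; subst; module ≡-Reasoning)

private
  variable
    A : Set

prepend-+ : (a : List A) (ω : Seq A) (m : ℕ) → prepend a ω (length a + m) ≡ ω m
prepend-+ a ω m with length a + m <? length a
... | yes a+m<a = ⊥-elim (m+n≮m (length a) m a+m<a)
... | no _      = cong ω (m+n∸m≡n (length a) m)

segment : Seq A → ℕ → ℕ → List A
segment s i n = applyUpTo (λ r → s (i + r)) n

segment-occurs : (s : Seq A) (i n : ℕ) → OccursAt s (segment s i n) i
segment-occurs s i n r r<n = sym (begin
  lookup (segment s i n) (fromℕ< r<n) ≡⟨ lookup-applyUpTo (λ r → s (i + r)) n (fromℕ< r<n) ⟩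
  s (i + _)                           ≡⟨ cong (λ r → s (i + r)) (toℕ-fromℕ< r<n) ⟩
  s (i + r)                           ∎)
  where open ≡-Reasoning

occurrences-agree : (s : Seq A) {x : List A} {i q : ℕ} →
                    OccursAt s x i → OccursAt s x q →
                    (r : ℕ) → r < length x → s (i + r) ≡ s (q + r)
occurrences-agree s occ-i occ-q r r<|x| = trans (occ-i r r<|x|) (sym (occ-q r r<|x|))

StronglyAlmostPeriodic⇒recurs-after : (s : Seq A) → StronglyAlmostPeriodic s →
                                      (i n p : ℕ) →
                                      ∃ λ d → (r : ℕ) → r ≤ n → s (i + r) ≡ s (p + d + r)
StronglyAlmostPeriodic⇒recurs-after s sap i n p
  with sap (segment s i (suc n)) ((λ ()) , i , segment-occurs s i (suc n))
... | _ , window with window p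
...   | d , _ , occ-d = d , λ r r≤n →
  occurrences-agree s (segment-occurs s i (suc n)) occ-d r
    (subst (r <_) (sym (length-applyUpTo (λ r → s (i + r)) (suc n))) (s≤s r≤n))

prepend-periodic-after : (a : List A) (ω : Seq A) (l : ℕ) → HasPeriod ω l →
                         (d : ℕ) → prepend a ω (length a + d) ≡ prepend a ω (length a + d + l)
prepend-periodic-after a ω l per d = begin
  prepend a ω (length a + d)       ≡⟨ prepend-+ a ω d ⟩
  ω d                              ≡⟨ per d ⟩
  ω (d + l)                        ≡⟨ sym (prepend-+ a ω (d + l)) ⟩
  prepend a ω (length a + (d + l)) ≡⟨ cong (prepend a ω) (sym (+-assoc (length a) d l)) ⟩
  prepend a ω (length a + d + l)   ∎
  where open ≡-Reasoning

lemma2 : (k : ℕ) (a : List (Fin k)) (ω : Seq (Fin k)) (l : ℕ)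
         → HasPeriod ω l
         → StronglyAlmostPeriodic (prepend a ω)
         → HasPeriod (prepend a ω) l
lemma2 k a ω l per sap i with StronglyAlmostPeriodic⇒recurs-after (prepend a ω) sap i l (length a)
... | d , recurs = begin
  s i                  ≡⟨ cong s (sym (+-identityʳ i)) ⟩
  s (i + 0)            ≡⟨ recurs 0 z≤n ⟩
  s (length a + d + 0) ≡⟨ cong s (+-identityʳ (length a + d)) ⟩
  s (length a + d)     ≡⟨ prepend-periodic-after a ω l per d ⟩
  s (length a + d + l) ≡⟨ sym (recurs l ≤-refl) ⟩
  s (i + l)            ∎
  where
  s = prepend a ω
  open ≡-Reasoning
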